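{- Let $A$ be a totally ordered alphabet, let $w$ be a Lyndon word over $A$, let $\mathfrak t=\mathrm{lst}(w)$ be its left Lyndon tree, and let $x$ be an internal node of $\mathfrak t$. Let $\mathrm{lss}(\mathfrak t,x)=(\mathfrak t_1,\dots,\mathfrak t_n)$ and let $\ell_i=\varphi(\mathfrak t_i)$ be the foliage of $\mathfrak t_i$ for each $i$. Then every $\ell_i$ is a Lyndon word, and $\ell_{i+1}$ is a prefix of $\ell_i$ for each $1\le i\le n-1$.
   Context: A nonempty word $w$ is a Lyndon word if for every factorization $w=uv$ with $u,v$ nonempty one has $w<v$ (lexicographic order). The left standard factorization of a Lyndon word $w$ with $|w|\ge2$ is $w=uv$ where $u$ is the longest nonempty proper prefix of $w$ that is a Lyndon word; then $u,v$ are Lyndon words. Complete (planar binary) trees over $A$: each letter is a tree, and if $\mathfrak t_1,\mathfrak t_2$ are trees then $(\mathfrak t_1,\mathfrak t_2)$ is a tree. The foliage $\varphi$ is defined by $\varphi(a)=a$ for letters and $\varphi((\mathfrak t_1,\mathfrak t_2))=\varphi(\mathfrak t_1)\varphi(\mathfrak t_2)$. The left Lyndon tree is defined by $\mathrm{lst}(a)=a$ for a letter $a$, and $\mathrm{lst}(w)=(\mathrm{lst}(u),\mathrm{lst}(v))$ if $w=uv$ is the left standard factorization of a Lyndon word $w$ of length at least $2$. For a tree $\mathfrak t=(\mathfrak t_1,\mathfrak t_2)$ and an internal node $x$ of $\mathfrak t$, the left subtrees sequence $\mathrm{lss}(\mathfrak t,x)$ is defined recursively: if $x$ is the root, $\mathrm{lss}(\mathfrak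 t,x)=(\mathfrak t_1)$; if $x$ lies in $\mathfrak t_1$, $\mathrm{lss}(\mathfrak t,x)=\mathrm{lss}(\mathfrak t_1,x)$; if $x$ lies in $\mathfrak t_2$, $\mathrm{lss}(\mathfrak t,x)$ is $\mathfrak t_1$ followed by the sequence $\mathrm{lss}(\mathfrak t_2,x)$. (It is the sequence of subtrees hanging to the left of the path from the root to $x$, including the left subtree of $x$.) -}

module Defs where

open import Level using (Level; _⊔_)
open import Data.Nat using (ℕ; _≤_; _≥_)
open import Data.List using (List; []; _∷_; _++_; length; map)
open import Data.Product using (Σ; ∃; _×_; _,_)
open import Relation.Binary.PropositionalEquality using (_≡_)
open import Relation.Binary.Core using (Rel)
open import Relation.Nullary using (¬_)

NonEmpty : ∀ {a} {A : Set a} → List A → Set a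
NonEmpty {A = A} w = Σ A λ x → Σ (List A) λ xs → w ≡ x ∷ xs

data Lex< {a ℓ} {A : Set a} (_<_ : Rel A ℓ) : Rel (List A) (a ⊔ ℓ) where
  []<∷  : ∀ {y ys} → Lex< _<_ [] (y ∷ ys)
  head< : ∀ {x y xs ys} → x < y → Lex< _<_ (x ∷ xs) (y ∷ ys)
  tail< : ∀ {x xs ys} → Lex< _<_ xs ys → Lex< _<_ (x ∷ xs) (x ∷ ys)

Lyndon : ∀ {a ℓ} {A : Set a} (_<_ : Rel A ℓ) → List A → Set (a ⊔ ℓ)
Lyndon _<_ w = NonEmpty w ×
  (∀ u v → NonEmpty u → NonEmpty v → w ≡ u ++ v → Lex< _<_ w v)

LeftStdFact : ∀ {a ℓ} {A : Set a} (_<_ : Rel A ℓ) → List A → List A → List A → Set (a ⊔ ℓ)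
LeftStdFact _<_ w u v =
  w ≡ u ++ v × NonEmpty u × NonEmpty v × Lyndon _<_ u ×
  (∀ u′ v′ → w ≡ u′ ++ v′ → NonEmpty u′ → NonEmpty v′ → Lyndon _<_ u′ → length u′ ≤ length u)

data Tree {a} (A : Set a) : Set a where
  leaf : A → Tree A
  node : Tree A → Tree A → Tree A

φ : ∀ {a} {A : Set a} → Tree A → List A
φ (leaf x)   = x ∷ []
φ (node l r) = φ l ++ φ r

-- IsLst _<_ w t  ⇔  t = lst(w)  (graph of the recursive definition of the left Lyndon tree).
data IsLst {a ℓ} {A : Set a} (_<_ : Rel A ℓ) : List A → Tree A → Set (a ⊔ ℓ) where
  lst-letter : ∀ x → IsLst _<_ (x ∷ []) (leaf x)
  lst-node   : ∀ {w u v t₁ t₂} → Lyndon _<_ w → length w ≥ 2 → LeftStdFact _<_ w u v →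
               IsLst _<_ u t₁ → IsLst _<_ v t₂ → IsLst _<_ w (node t₁ t₂)

-- Internal nodes of a tree, given by their path from the root.
data Internal {a} {A : Set a} : Tree A → Set a where
  here  : ∀ {l r} → Internal (node l r)
  left  : ∀ {l r} → Internal l → Internal (node l r)
  right : ∀ {l r} → Internal r → Internal (node l r)

lss : ∀ {a} {A : Set a} (t : Tree A) → Internal t → List (Tree A)
lss (node l r) here      = l ∷ []
lss (node l r) (left x)  = lss l x
lss (node l r) (right x) = l ∷ lss r x

IsPrefixOf : ∀ {a} {A : Set a} → List A → List A → Set a
IsPrefixOf {A = A} u w = Σ (List A) λ s → w ≡ u ++ s

-- Walking down lst(w) towards x, the sequence only changes when the path turns right at a
-- node with standard factorization uv: then u is put in front of lss(lst(v), x), whose head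
-- p is a Lyndon proper prefix of v. If p were not a prefix of u, either p and u differ at
-- some letter with p smaller, so that v < uv = w against w being Lyndon, or u < p, so that
-- up is Lyndon and a longer Lyndon proper prefix of w than u, against the choice of u.
module Submission where

open import Defs
open import Level using (Level)
open import Data.Empty using (⊥-elim)
import Data.Empty.Polymorphic as Poly
open import Data.List using (List; map; []; _∷_; _++_; length)
open import Data.List.Properties using (++-assoc; ++-identityʳ; length-++; ∷-injective)
open import Data.List.Relation.Unary.All using (All; []; _∷_)
open import Data.List.Relation.Unary.Linked using (Linked; [-]; _∷_)
open import Data.Nat using (_≤_; s≤s)
open import Data.Nat.Properties using (≤-trans; ≤-reflexive; m≤n+m; m+1+n≰m)
open import Data.Product using (Σ; _×_; _,_; proj₁; proj₂)
open import Data.Sum using (_⊎_; inj₁; inj₂)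
open import Relation.Binary.Core using (Rel)
open import Relation.Binary.Definitions using (Transitive; Irreflexive; Trichotomous; tri<; tri≈; tri>)
open import Relation.Binary.PropositionalEquality using (_≡_; refl; sym; trans; cong; subst)
open import Relation.Binary.Structures using (IsStrictTotalOrder)

private
  variable
    a ℓ : Level
    A : Set a

NonEmpty-++ : ∀ {x : List A} (s : List A) → NonEmpty x → NonEmpty (x ++ s)
NonEmpty-++ s (c , xs , refl) = c , xs ++ s , refl

length-suffix≤ : ∀ (x s : List A) → length s ≤ length (x ++ s)
length-suffix≤ x s = ≤-trans (m≤n+m (length s) (length x)) (≤-reflexive (sym (length-++ x)))

++≡++-split : ∀ (u v x s : List A) → u ++ v ≡ x ++ s →
  (Σ (List A) λ m → u ≡ x ++ m × s ≡ m ++ v) ⊎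
  (Σ (List A) λ m → x ≡ u ++ m × v ≡ m ++ s)
++≡++-split u       v []      s eq = inj₁ (u , refl , sym eq)
++≡++-split []      v (c ∷ x) s eq = inj₂ (c ∷ x , refl , eq)
++≡++-split (c ∷ u) v (d ∷ x) s eq with ∷-injective eq
... | refl , eq′ with ++≡++-split u v x s eq′
...   | inj₁ (m , u≡ , s≡) = inj₁ (m , cong (c ∷_) u≡ , s≡)
...   | inj₂ (m , x≡ , v≡) = inj₂ (m , cong (c ∷_) x≡ , v≡)

module _ {_<_ : Rel A ℓ} where

  private
    _≺_ = Lex< _<_

  Lex<-trans : Transitive _<_ → Transitive _≺_
  Lex<-trans <-trans []<∷      (head< _) = []<∷
  Lex<-trans <-trans []<∷      (tail< _) = []<∷
  Lex<-trans <-trans (head< p) (head< q) = head< (<-trans p q)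
  Lex<-trans <-trans (head< p) (tail< _) = head< p
  Lex<-trans <-trans (tail< _) (head< q) = head< q
  Lex<-trans <-trans (tail< p) (tail< q) = tail< (Lex<-trans <-trans p q)

  Lex<-irrefl : Irreflexive _≡_ _<_ → Irreflexive _≡_ _≺_
  Lex<-irrefl <-irrefl refl (head< p) = <-irrefl refl p
  Lex<-irrefl <-irrefl refl (tail< p) = Lex<-irrefl <-irrefl refl p

  Lex<-++ˡ : ∀ u {x y} → x ≺ y → (u ++ x) ≺ (u ++ y)
  Lex<-++ˡ []      p = p
  Lex<-++ˡ (c ∷ u) p = tail< (Lex<-++ˡ u p)

  Lex<-++-++ : ∀ {x y} → x ≺ y → length y ≤ length x → ∀ c d → (x ++ c) ≺ (y ++ d)
  Lex<-++-++ (head< p) _       c d = head< p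
  Lex<-++-++ (tail< p) (s≤s n) c d = tail< (Lex<-++-++ p n c d)

  Lex<-properPrefix⊎++-++ : ∀ {x y} → x ≺ y →
    (Σ (List A) λ y′ → y ≡ x ++ y′ × NonEmpty y′) ⊎ (∀ c d → (x ++ c) ≺ (y ++ d))
  Lex<-properPrefix⊎++-++ ([]<∷ {y} {ys}) = inj₁ (y ∷ ys , refl , y , ys , refl)
  Lex<-properPrefix⊎++-++ (head< p)       = inj₂ (λ c d → head< p)
  Lex<-properPrefix⊎++-++ (tail< p) with Lex<-properPrefix⊎++-++ p
  ... | inj₁ (y′ , refl , ne) = inj₁ (y′ , refl , ne)
  ... | inj₂ ext              = inj₂ (λ c d → tail< (ext c d))

  prefix⊎Lex<⊎++-++ : Trichotomous _≡_ _<_ → ∀ (p u : List A) →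
    IsPrefixOf p u ⊎ u ≺ p ⊎ (∀ c d → (p ++ c) ≺ (u ++ d))
  prefix⊎Lex<⊎++-++ compare []      u       = inj₁ (u , refl)
  prefix⊎Lex<⊎++-++ compare (x ∷ p) []      = inj₂ (inj₁ []<∷)
  prefix⊎Lex<⊎++-++ compare (x ∷ p) (y ∷ u) with compare x y
  ... | tri< x<y _ _ = inj₂ (inj₂ (λ c d → head< x<y))
  ... | tri> _ _ y<x = inj₂ (inj₁ (head< y<x))
  ... | tri≈ _ refl _ with prefix⊎Lex<⊎++-++ compare p u
  ...   | inj₁ (s , u≡) = inj₁ (s , cong (x ∷_) u≡)
  ...   | inj₂ (inj₁ u≺p) = inj₂ (inj₁ (tail< u≺p))
  ...   | inj₂ (inj₂ ext) = inj₂ (inj₂ (λ c d → tail< (ext c d)))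

  Lyndon-++<ʳ : ∀ {u v} → Lyndon _<_ u → Lyndon _<_ v → u ≺ v → (u ++ v) ≺ v
  Lyndon-++<ʳ {u} {v} lu lv u≺v with Lex<-properPrefix⊎++-++ u≺v
  ... | inj₁ (v′ , refl , ne) = Lex<-++ˡ u (proj₂ lv u v′ (proj₁ lu) ne refl)
  ... | inj₂ ext              = subst ((u ++ v) ≺_) (++-identityʳ v) (ext v [])

  Lyndon-++ : Transitive _<_ → ∀ {u v} → Lyndon _<_ u → Lyndon _<_ v → u ≺ v →
    Lyndon _<_ (u ++ v)
  Lyndon-++ <-trans {u} {v} lu lv u≺v = NonEmpty-++ v (proj₁ lu) , uv<suffix
    where
    uv<suffix : ∀ x s → NonEmpty x → NonEmpty s → u ++ v ≡ x ++ s → (u ++ v) ≺ s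
    uv<suffix x s nx ns eq with ++≡++-split u v x s eq
    ... | inj₁ ([] , _ , refl) = Lyndon-++<ʳ lu lv u≺v
    ... | inj₁ (c ∷ m , refl , refl) =
      Lex<-++-++ (proj₂ lu x (c ∷ m) nx (c , m , refl) refl) (length-suffix≤ x (c ∷ m)) v v
    ... | inj₂ ([] , refl , refl) = Lyndon-++<ʳ lu lv u≺v
    ... | inj₂ (c ∷ m , refl , refl) =
      Lex<-trans <-trans (Lyndon-++<ʳ lu lv u≺v) (proj₂ lv (c ∷ m) s (c , m , refl) ns refl)

φ-NonEmpty : ∀ (t : Tree A) → NonEmpty (φ t)
φ-NonEmpty (leaf x)   = x , [] , refl
φ-NonEmpty (node l r) = NonEmpty-++ (φ r) (φ-NonEmpty l)

IsLst⇒φ≡ : ∀ {_<_ : Rel A ℓ} {w t} → IsLst _<_ w t → φ t ≡ w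
IsLst⇒φ≡ (lst-letter x) = refl
IsLst⇒φ≡ (lst-node _ _ (w≡uv , _) p q) rewrite IsLst⇒φ≡ p | IsLst⇒φ≡ q = sym w≡uv

HeadIsProperPrefixOf : List (List A) → List A → Set _
HeadIsProperPrefixOf []      w = Poly.⊥
HeadIsProperPrefixOf (p ∷ _) w = Σ _ λ rest → w ≡ p ++ rest × NonEmpty rest

lss-head-properPrefix : ∀ (t : Tree A) (x : Internal t) →
  HeadIsProperPrefixOf (map φ (lss t x)) (φ t)
lss-head-properPrefix (node l r) here      = φ r , refl , φ-NonEmpty r
lss-head-properPrefix (node l r) (right x) = φ r , refl , φ-NonEmpty r
lss-head-properPrefix (node l r) (left x) with lss l x | lss-head-properPrefix l x
... | t₀ ∷ _ | rest , l≡ , ne =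
  rest ++ φ r , trans (cong (_++ φ r) l≡) (++-assoc (φ t₀) rest (φ r)) , NonEmpty-++ (φ r) ne

module _ {_<_ : Rel A ℓ} (sto : IsStrictTotalOrder _≡_ _<_) where

  open IsStrictTotalOrder sto using (compare) renaming (trans to <-trans; irrefl to <-irrefl)

  LeftStdFact-prefix : ∀ {w u v p rest} →
    Lyndon _<_ w → LeftStdFact _<_ w u v → Lyndon _<_ p → v ≡ p ++ rest → NonEmpty rest →
    IsPrefixOf p u
  LeftStdFact-prefix {u = u} {p = p} {rest} lw (refl , nu , nv , lu , maximal) lp refl nr
    with prefix⊎Lex<⊎++-++ compare p u
  ... | inj₁ p⊑u = p⊑u
  ... | inj₂ (inj₂ ext) =
    ⊥-elim (Lex<-irrefl <-irrefl refl
      (Lex<-trans <-trans (proj₂ lw u _ nu nv refl) (ext rest (p ++ rest))))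
  ... | inj₂ (inj₁ u≺p) with proj₁ lp
  ...   | c , p′ , refl = ⊥-elim (m+1+n≰m (length u) (subst (_≤ length u) (length-++ u)
          (maximal (u ++ p) rest (sym (++-assoc u p rest)) (NonEmpty-++ p nu) nr
             (Lyndon-++ <-trans lu lp u≺p))))

  lss-Lyndon-prefixChain : ∀ {w t} → IsLst _<_ w t → (x : Internal t) →
    All (Lyndon _<_) (map φ (lss t x)) ×
    Linked (λ ℓᵢ ℓᵢ₊₁ → IsPrefixOf ℓᵢ₊₁ ℓᵢ) (map φ (lss t x))
  lss-Lyndon-prefixChain (lst-node _ _ (_ , _ , _ , lu , _) p _) here
    rewrite IsLst⇒φ≡ p = lu ∷ [] , [-]
  lss-Lyndon-prefixChain (lst-node _ _ _ p _) (left x) = lss-Lyndon-prefixChain p x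
  lss-Lyndon-prefixChain {t = node l r} (lst-node lw _ fact@(_ , _ , _ , lu , _) p q) (right x)
    with lss r x | lss-head-properPrefix r x | lss-Lyndon-prefixChain q x
  ... | t₀ ∷ _ | rest , r≡ , ne | lt₀ ∷ lyndons , chain
    rewrite IsLst⇒φ≡ p | IsLst⇒φ≡ q =
    lu ∷ lt₀ ∷ lyndons ,
    LeftStdFact-prefix lw fact lt₀ r≡ ne ∷ chain

lemma5 : ∀ {a ℓ} {A : Set a} (_<_ : Rel A ℓ) → IsStrictTotalOrder _≡_ _<_ →
    ∀ (w : List A) (t : Tree A) → Lyndon _<_ w → IsLst _<_ w t →
    (x : Internal t) →
    All (Lyndon _<_) (map φ (lss t x)) ×
    Linked (λ ℓᵢ ℓᵢ₊₁ → IsPrefixOf ℓᵢ₊₁ ℓᵢ) (map φ (lss t x))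
-- The Lyndon property of w is already recorded in every lst-node of the derivation.
lemma5 _<_ sto w t _ lst x = lss-Lyndon-prefixChain sto lst x
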